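{- Let $n\ge3$ be prime and let $m$ be a positive integer with $\gcd(m,n)=1$. Let $L_n$ be the $n\times n$ matrix indexed by $0,\ldots,n-1$ with $(0,0)$ entry $3$, $(i,i)$ entry $2$ for $1\le i\le n-1$, entry $-1$ in positions $(i,j)$ with $j\equiv i\pm1\pmod n$, and $0$ elsewhere (the Laplacian of the leafed $n$-cycle minored at its leaf), and let $\mathcal{C}_n=\{\lambda\in\mathbb{R}^n:L_n\lambda\ge0\}$. Then the number of integer points $\lambda=(\lambda_0,\ldots,\lambda_{n-1})\in\mathcal{C}_n\cap\mathbb{Z}^n$ with $\lambda_0=m$ equals the number of compositions of $m$ into $n$ parts up to cyclic shift, i.e. the number of orbits of the set $\{(c_0,\ldots,c_{n-1})\in\mathbb{Z}_{\ge0}^n:\sum c_i=m\}$ under the cyclic rotation $(c_0,\ldots,c_{n-1})\mapsto(c_1,\ldots,c_{n-1},c_0)$.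
   Context: Compositions here are weak compositions (parts may be $0$). The leafed $n$-cycle is the $n$-cycle on $0,\ldots,n-1$ with an extra vertex $n$ adjacent only to $0$. -}

module Defs where

open import Data.Nat as ℕ using (ℕ; zero; suc; _%_)
open import Data.Integer as ℤ using (ℤ; +_; -[1+_]; _≤_)
open import Data.Fin as Fin using (Fin; toℕ)
open import Data.Vec as Vec using (Vec; lookup; _∷_; []; _∷ʳ_)


open import Data.Bool using (Bool; true; false; if_then_else_; _∨_)
open import Data.Nat.Base using (_≡ᵇ_)
open import Data.Product using (Σ; ∃; _×_; _,_)
open import Data.List using (List; length)
open import Data.List.Membership.Propositional using (_∈_)
open import Data.List.Relation.Unary.Unique.Propositional using (Unique)
open import Data.List.Relation.Unary.AllPairs using (AllPairs)
open import Data.List.Relation.Unary.All using (All)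
open import Data.List.Relation.Unary.Any using (Any)
open import Relation.Binary.PropositionalEquality using (_≡_)
open import Relation.Nullary using (¬_)
open import Function.Bundles using (_⇔_)

Σℤ : (n : ℕ) → (Fin n → ℤ) → ℤ
Σℤ zero    f = + 0
Σℤ (suc n) f = f Fin.zero ℤ.+ Σℤ n (λ i → f (Fin.suc i))

Lmat : (n : ℕ) .{{_ : ℕ.NonZero n}} → Fin n → Fin n → ℤ
Lmat n i j =
  if toℕ i ≡ᵇ toℕ j
    then (if toℕ i ≡ᵇ 0 then + 3 else + 2)
    else (if (toℕ j ≡ᵇ (suc (toℕ i)) % n) ∨ (toℕ i ≡ᵇ (suc (toℕ j)) % n)
            then -[1+ 0 ] else + 0)

Lapply : (n : ℕ) .{{_ : ℕ.NonZero n}} → Vec ℤ n → Fin n → ℤ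
Lapply n λv i = Σℤ n (λ j → Lmat n i j ℤ.* lookup λv j)

-- λ ∈ C_n ∩ ℤ^n with λ_0 = m  (n = suc n' so that index 0 exists).
ConePoint : (n' : ℕ) → ℕ → Vec ℤ (suc n') → Set
ConePoint n' m λv =
  (∀ i → + 0 ≤ Lapply (suc n') λv i) × lookup λv Fin.zero ≡ + m

sumℕ : ∀ {n} → Vec ℕ n → ℕ
sumℕ []       = 0
sumℕ (x ∷ xs) = x ℕ.+ sumℕ xs

IsComposition : (n m : ℕ) → Vec ℕ n → Set
IsComposition n m c = sumℕ c ≡ m

rotate : ∀ {n} → Vec ℕ n → Vec ℕ n
rotate []       = []
rotate (x ∷ xs) = xs ∷ʳ x

rotate^ : ∀ {n} → ℕ → Vec ℕ n → Vec ℕ n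
rotate^ zero    c = c
rotate^ (suc k) c = rotate (rotate^ k c)

SameOrbit : ∀ {n} → Vec ℕ n → Vec ℕ n → Set
SameOrbit c d = ∃ λ k → rotate^ k c ≡ d

HasSize : {A : Set} → (A → Set) → ℕ → Set
HasSize {A} P k = Σ (List A) λ xs →
  length xs ≡ k × Unique xs × (∀ x → (P x ⇔ (x ∈ xs)))

NumOrbits : (n m k : ℕ) → Set
NumOrbits n m k = Σ (List (Vec ℕ n)) λ reps →
  length reps ≡ k
  × All (IsComposition n m) reps
  × AllPairs (λ c d → ¬ SameOrbit c d) reps
  × (∀ c → IsComposition n m c → Any (SameOrbit c) reps)

module Submission where

-- Write c = L λ for a cone point λ with λ₀ = m. Rows 1, …, n-2 of L are second differences, so λ is
-- determined by c and the slope u = λ₁ - λ₀ + c₀, namely λₖ = m + k u - Σ_{i<k} (c₀ + … + cᵢ).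
-- The two remaining rows hold exactly when Σ cᵢ = m and the recursion closes up (λₙ = m), that is,
-- when the moment Σᵢ (n - i) cᵢ equals n u. So the cone points with λ₀ = m correspond to the
-- compositions of m whose moment is divisible by n. Rotating a composition of m changes its moment
-- by m modulo n, and m is a unit modulo n, so each rotation orbit contains exactly one of them.

open import Defs
open import Data.Nat as ℕ using (ℕ; zero; suc; _≤_; _<_; z≤n; s≤s)
open import Data.Nat.Primality using (Prime)
open import Data.Nat.Coprimality using (Coprime)
open import Data.Vec using (Vec; []; _∷_)
open import Data.List as List using (List; length)
open import Data.List.Membership.Propositional using (_∈_)
open import Data.List.Membership.Propositional.Properties using (∈-map⁺; ∈-map⁻)
import Data.List.Relation.Unary.All as All
open import Data.List.Relation.Unary.Any as Any using (Any; here; there)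
open import Data.List.Relation.Unary.AllPairs as AllPairs using (AllPairs)
import Data.List.Relation.Unary.AllPairs.Properties as AllPairsₚ
open import Data.List.Relation.Unary.Unique.Propositional using (Unique)
open import Data.Product using (∃; ∃-syntax; _×_; _,_; proj₁; proj₂)
open import Data.Sum using (_⊎_; inj₁; inj₂)
open import Function.Bundles using (_⇔_; mk⇔; Equivalence)
open import Relation.Binary.PropositionalEquality
  using (_≡_; _≢_; refl; sym; trans; cong; cong₂; subst; module ≡-Reasoning)
open import Relation.Nullary using (¬_)

AllPairs-weaken-∈ : ∀ {A : Set} {R S : A → A → Set} {xs : List A} →
  (∀ {a b} → a ∈ xs → b ∈ xs → R a b → S a b) → AllPairs R xs → AllPairs S xs
AllPairs-weaken-∈ {xs = List.[]} f AllPairs.[] = AllPairs.[]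
AllPairs-weaken-∈ {xs = x List.∷ xs} f (Rx AllPairs.∷ Rxs) =
  All.tabulate (λ b∈xs → f (here refl) (there b∈xs) (All.lookup Rx b∈xs))
  AllPairs.∷ AllPairs-weaken-∈ (λ a∈xs b∈xs → f (there a∈xs) (there b∈xs)) Rxs

module CyclicCompositions where

  open import Data.Nat using (_+_; _*_)
  open import Data.Nat.Properties using (+-comm; +-assoc; *-comm; *-assoc; +-identityʳ; suc-injective)
  open import Data.Nat.Divisibility using (_∣_; _∣?_; ∣m+n∣m⇒∣n; ∣m∣n⇒∣m+n; m∣m*n; divides)
  open import Data.Nat.Coprimality using (coprime-divisor; coprime-Bézout)
  import Data.Nat.Coprimality as Coprime
  open import Data.Nat.GCD using (module Bézout)
  open import Data.Nat.Tactic.RingSolver using (solve-∀)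
  open import Data.Vec using (_∷ʳ_; head; replicate; toList)
  open import Data.Vec.Relation.Binary.Equality.Cast using (cast-is-id)
  open import Data.Vec.Properties using (toList-∷ʳ; toList-injective; length-toList)
  open import Data.List using ([_]; _++_; filter)
  open import Data.List.Properties using (++-assoc; ++-identityʳ)
  open import Data.List.Membership.Propositional.Properties
    using (∈-++⁺ˡ; ∈-++⁺ʳ; ∈-++⁻; ∈-filter⁺; ∈-filter⁻)
  import Data.List.Relation.Unary.Unique.Propositional.Properties as Unique

  incrementHead : ∀ {n} → Vec ℕ (suc n) → Vec ℕ (suc n)
  incrementHead (x ∷ xs) = suc x ∷ xs

  compositions : (n m : ℕ) → List (Vec ℕ n)
  compositions zero    zero    = [ [] ]
  compositions zero    (suc m) = List.[]
  compositions (suc n) zero    = [ replicate (suc n) 0 ]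
  compositions (suc n) (suc m) =
    List.map (0 ∷_) (compositions n (suc m)) ++ List.map incrementHead (compositions (suc n) m)

  ∈-compositions⇒IsComposition : ∀ n m {c} → c ∈ compositions n m → IsComposition n m c
  ∈-compositions⇒IsComposition zero zero {[]} _ = refl
  ∈-compositions⇒IsComposition (suc n) zero (here refl) = sum-replicate-0 (suc n)
    where
    sum-replicate-0 : ∀ k → sumℕ (replicate k 0) ≡ 0
    sum-replicate-0 zero    = refl
    sum-replicate-0 (suc k) = sum-replicate-0 k
  ∈-compositions⇒IsComposition (suc n) (suc m) c∈ with ∈-++⁻ (List.map (0 ∷_) (compositions n (suc m))) c∈
  ... | inj₁ c∈ˡ with ∈-map⁻ (0 ∷_) c∈ˡ
  ...   | d , d∈ , refl = ∈-compositions⇒IsComposition n (suc m) d∈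
  ∈-compositions⇒IsComposition (suc n) (suc m) c∈ | inj₂ c∈ʳ with ∈-map⁻ incrementHead c∈ʳ
  ...   | (x ∷ d) , d∈ , refl = cong suc (∈-compositions⇒IsComposition (suc n) m d∈)

  IsComposition⇒∈-compositions : ∀ n m (c : Vec ℕ n) → IsComposition n m c → c ∈ compositions n m
  IsComposition⇒∈-compositions zero    zero    []  _  = here refl
  IsComposition⇒∈-compositions (suc n) zero    c   Σc = here (sum≡0⇒replicate-0 c Σc)
    where
    sum≡0⇒replicate-0 : ∀ {k} (v : Vec ℕ k) → sumℕ v ≡ 0 → v ≡ replicate k 0
    sum≡0⇒replicate-0 []         _  = refl
    sum≡0⇒replicate-0 (zero ∷ v) Σv = cong (0 ∷_) (sum≡0⇒replicate-0 v Σv)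
  IsComposition⇒∈-compositions (suc n) (suc m) (zero ∷ xs) Σc =
    ∈-++⁺ˡ (∈-map⁺ (0 ∷_) (IsComposition⇒∈-compositions n (suc m) xs Σc))
  IsComposition⇒∈-compositions (suc n) (suc m) (suc x ∷ xs) Σc =
    ∈-++⁺ʳ (List.map (0 ∷_) (compositions n (suc m)))
      (∈-map⁺ incrementHead (IsComposition⇒∈-compositions (suc n) m (x ∷ xs) (suc-injective Σc)))

  compositions-unique : ∀ n m → Unique (compositions n m)
  compositions-unique zero    zero    = All.[] AllPairs.∷ AllPairs.[]
  compositions-unique zero    (suc m) = AllPairs.[]
  compositions-unique (suc n) zero    = All.[] AllPairs.∷ AllPairs.[]
  compositions-unique (suc n) (suc m) =
    Unique.++⁺ (Unique.map⁺ ∷-injectiveʳ (compositions-unique n (suc m)))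
               (Unique.map⁺ incrementHead-injective (compositions-unique (suc n) m))
               head-zero-and-positive
    where
    ∷-injectiveʳ : ∀ {x y : Vec ℕ n} → 0 ∷ x ≡ 0 ∷ y → x ≡ y
    ∷-injectiveʳ refl = refl
    incrementHead-injective : ∀ {x y : Vec ℕ (suc n)} → incrementHead x ≡ incrementHead y → x ≡ y
    incrementHead-injective {_ ∷ _} {_ ∷ _} refl = refl
    head-zero-and-positive : ∀ {v} →
      ¬ (v ∈ List.map (0 ∷_) (compositions n (suc m)) × v ∈ List.map incrementHead (compositions (suc n) m))
    head-zero-and-positive (v∈ˡ , v∈ʳ) with ∈-map⁻ (0 ∷_) v∈ˡ | ∈-map⁻ incrementHead v∈ʳ
    ... | _ , _ , refl | (_ ∷ _) , _ , ()

  rotateList : List ℕ → List ℕ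
  rotateList List.[]         = List.[]
  rotateList (x List.∷ xs) = xs ++ [ x ]

  rotateList^ : ℕ → List ℕ → List ℕ
  rotateList^ zero    xs = xs
  rotateList^ (suc k) xs = rotateList (rotateList^ k xs)

  rotateList^-suc : ∀ k xs → rotateList^ (suc k) xs ≡ rotateList^ k (rotateList xs)
  rotateList^-suc zero    xs = refl
  rotateList^-suc (suc k) xs = cong rotateList (rotateList^-suc k xs)

  rotateList^-++ : ∀ xs ys → rotateList^ (length xs) (xs ++ ys) ≡ ys ++ xs
  rotateList^-++ List.[]         ys = sym (++-identityʳ ys)
  rotateList^-++ (x List.∷ xs) ys = begin
    rotateList^ (suc (length xs)) (x List.∷ xs ++ ys) ≡⟨ rotateList^-suc (length xs) _ ⟩
    rotateList^ (length xs) ((xs ++ ys) ++ [ x ])    ≡⟨ cong (rotateList^ (length xs)) (++-assoc xs ys [ x ]) ⟩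
    rotateList^ (length xs) (xs ++ ys ++ [ x ])      ≡⟨ rotateList^-++ xs (ys ++ [ x ]) ⟩
    (ys ++ [ x ]) ++ xs                              ≡⟨ ++-assoc ys [ x ] xs ⟩
    ys ++ x List.∷ xs                                ∎
    where open ≡-Reasoning

  toList-rotate^ : ∀ {n} k (c : Vec ℕ n) → toList (rotate^ k c) ≡ rotateList^ k (toList c)
  toList-rotate^ zero    c = refl
  toList-rotate^ (suc k) c = trans (toList-rotate (rotate^ k c)) (cong rotateList (toList-rotate^ k c))
    where
    toList-rotate : ∀ {n} (v : Vec ℕ n) → toList (rotate v) ≡ rotateList (toList v)
    toList-rotate []       = refl
    toList-rotate (x ∷ xs) = toList-∷ʳ x xs

  rotate^-period : ∀ {n} (c : Vec ℕ n) → rotate^ n c ≡ c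
  rotate^-period {n} c = trans (sym (cast-is-id refl (rotate^ n c))) (toList-injective refl (rotate^ n c) c (begin
    toList (rotate^ n c)                   ≡⟨ toList-rotate^ n c ⟩
    rotateList^ n xs                       ≡⟨ cong (λ k → rotateList^ k xs) (length-toList c) ⟨
    rotateList^ (length xs) xs             ≡⟨ cong (rotateList^ (length xs)) (++-identityʳ xs) ⟨
    rotateList^ (length xs) (xs ++ List.[]) ≡⟨ rotateList^-++ xs List.[] ⟩
    xs                                     ∎))
    where
    open ≡-Reasoning
    xs = toList c

  rotate^-+ : ∀ {n} a b (c : Vec ℕ n) → rotate^ (a + b) c ≡ rotate^ a (rotate^ b c)
  rotate^-+ zero    b c = refl
  rotate^-+ (suc a) b c = cong rotate (rotate^-+ a b c)

  rotate^-multiple : ∀ {n} q (c : Vec ℕ n) → rotate^ (q * n) c ≡ c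
  rotate^-multiple zero        c = refl
  rotate^-multiple {n} (suc q) c = begin
    rotate^ (n + q * n) c         ≡⟨ rotate^-+ n (q * n) c ⟩
    rotate^ n (rotate^ (q * n) c) ≡⟨ cong (rotate^ n) (rotate^-multiple q c) ⟩
    rotate^ n c                   ≡⟨ rotate^-period c ⟩
    c                             ∎
    where open ≡-Reasoning

  sum-∷ʳ : ∀ {n} (xs : Vec ℕ n) x → sumℕ (xs ∷ʳ x) ≡ sumℕ xs + x
  sum-∷ʳ []       x = +-comm x 0
  sum-∷ʳ (y ∷ xs) x = trans (cong (y +_) (sum-∷ʳ xs x)) (sym (+-assoc y _ x))

  sum-rotate : ∀ {n} (c : Vec ℕ n) → sumℕ (rotate c) ≡ sumℕ c
  sum-rotate []       = refl
  sum-rotate (x ∷ xs) = trans (sum-∷ʳ xs x) (+-comm _ x)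

  sum-rotate^ : ∀ {n} k (c : Vec ℕ n) → sumℕ (rotate^ k c) ≡ sumℕ c
  sum-rotate^ zero    c = refl
  sum-rotate^ (suc k) c = trans (sum-rotate (rotate^ k c)) (sum-rotate^ k c)

  moment : ∀ {n} → Vec ℕ n → ℕ
  moment []                 = 0
  moment {suc n} (x ∷ xs) = suc n * x + moment xs

  moment-∷ʳ : ∀ {n} (xs : Vec ℕ n) x → moment (xs ∷ʳ x) ≡ moment xs + sumℕ xs + x
  moment-∷ʳ []               x = trans (+-identityʳ (x + 0)) (+-identityʳ x)
  moment-∷ʳ {suc n} (y ∷ xs) x rewrite moment-∷ʳ xs x = lemma (n * y) y (moment xs) (sumℕ xs) x
    where
    lemma : ∀ a y q s x → y + (y + a) + (q + s + x) ≡ y + a + q + (y + s) + x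
    lemma = solve-∀

  moment-rotate : ∀ {n} (c : Vec ℕ (suc n)) → moment (rotate c) + suc n * head c ≡ moment c + sumℕ c
  moment-rotate {n} (x ∷ xs) rewrite moment-∷ʳ xs x = lemma (suc n * x) (moment xs) (sumℕ xs) x
    where
    lemma : ∀ a q s x → q + s + x + a ≡ a + q + (x + s)
    lemma = solve-∀

  moment-rotate^ : ∀ {n} k (c : Vec ℕ (suc n)) →
    ∃[ t ] moment (rotate^ k c) + suc n * t ≡ moment c + k * sumℕ c
  moment-rotate^ {n} zero c = 0 , lemma (moment c) (suc n) (sumℕ c)
    where
    lemma : ∀ q n s → q + n * 0 ≡ q + 0 * s
    lemma = solve-∀
  moment-rotate^ {n} (suc k) c with moment-rotate^ k c
  ... | t , eq = t + head c′ , (begin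
    moment (rotate c′) + suc n * (t + head c′)          ≡⟨ lemma (moment (rotate c′)) (suc n) t (head c′) ⟩
    (moment (rotate c′) + suc n * head c′) + suc n * t  ≡⟨ cong (_+ suc n * t) (moment-rotate c′) ⟩
    moment c′ + sumℕ c′ + suc n * t                     ≡⟨ cong (λ s → moment c′ + s + suc n * t) (sum-rotate^ k c) ⟩
    moment c′ + sumℕ c + suc n * t                      ≡⟨ lemma′ (moment c′) (sumℕ c) (suc n * t) ⟩
    (moment c′ + suc n * t) + sumℕ c                    ≡⟨ cong (_+ sumℕ c) eq ⟩
    moment c + k * sumℕ c + sumℕ c                      ≡⟨ lemma″ (moment c) k (sumℕ c) ⟩
    moment c + suc k * sumℕ c                           ∎)
    where
    open ≡-Reasoning
    c′ = rotate^ k c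
    lemma : ∀ r n t x → r + n * (t + x) ≡ r + n * x + n * t
    lemma = solve-∀
    lemma′ : ∀ r s u → r + s + u ≡ r + u + s
    lemma′ = solve-∀
    lemma″ : ∀ q k s → q + k * s + s ≡ q + (s + k * s)
    lemma″ = solve-∀

  Balanced : ∀ {n} → Vec ℕ n → Set
  Balanced {n} c = n ∣ moment c

  balanced-rotate^ : ∀ {n} k (c : Vec ℕ (suc n)) → Balanced (rotate^ k c) ⇔ suc n ∣ moment c + k * sumℕ c
  balanced-rotate^ {n} k c with moment-rotate^ k c
  ... | t , eq = mk⇔
    (λ n∣c′ → subst (suc n ∣_) eq (∣m∣n⇒∣m+n n∣c′ (m∣m*n t)))
    (λ n∣rhs → ∣m+n∣m⇒∣n (subst (suc n ∣_) (trans (sym eq) (+-comm _ (suc n * t))) n∣rhs) (m∣m*n t))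

  coprime-∣+*⇒∣ : ∀ {m n a} k → Coprime m n → n ∣ a → n ∣ a + k * m → n ∣ k
  coprime-∣+*⇒∣ {m} {n} {a} k cop n∣a n∣a+km =
    coprime-divisor (Coprime.sym cop) (subst (n ∣_) (*-comm k m) (∣m+n∣m⇒∣n n∣a+km n∣a))

  -- Bézout gives x with x m ≡ ∓1 (mod n); then k = a x, resp. k = a (n - 1) x, makes a + k m ≡ 0.
  coprime⇒∃∣+* : ∀ {m n} → Coprime m (suc n) → ∀ a → ∃[ k ] suc n ∣ a + k * m
  coprime⇒∃∣+* {m} {n} cop a with coprime-Bézout cop
  ... | Bézout.-+ x y 1+xm≡yN = a * x , divides (a * y) (begin
    a + a * x * m     ≡⟨ lemma a x m ⟩
    a * (1 + x * m)   ≡⟨ cong (a *_) 1+xm≡yN ⟩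
    a * (y * suc n)   ≡⟨ *-assoc a y (suc n) ⟨
    a * y * suc n     ∎)
    where
    open ≡-Reasoning
    lemma : ∀ a x m → a + a * x * m ≡ a * (1 + x * m)
    lemma = solve-∀
  ... | Bézout.+- x y 1+yN≡xm = a * n * x , divides (a + a * n * y) (begin
    a + a * n * x * m          ≡⟨ lemma a n x m ⟩
    a + a * n * (x * m)        ≡⟨ cong (λ z → a + a * n * z) 1+yN≡xm ⟨
    a + a * n * (1 + y * suc n) ≡⟨ lemma′ a n y ⟩
    (a + a * n * y) * suc n    ∎)
    where
    open ≡-Reasoning
    lemma : ∀ a n x m → a + a * n * x * m ≡ a + a * n * (x * m)
    lemma = solve-∀
    lemma′ : ∀ a n y → a + a * n * (1 + y * suc n) ≡ (a + a * n * y) * suc n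
    lemma′ = solve-∀

  balancedCompositions : (n m : ℕ) → List (Vec ℕ n)
  balancedCompositions n m = filter (λ c → n ∣? moment c) (compositions n m)

  ∈-balancedCompositions : ∀ {n m c} → c ∈ balancedCompositions n m ⇔ (IsComposition n m c × Balanced c)
  ∈-balancedCompositions {n} {m} {c} = mk⇔
    (λ c∈ → let c∈all , bal = ∈-filter⁻ (λ v → n ∣? moment v) c∈ in
      ∈-compositions⇒IsComposition n m c∈all , bal)
    (λ (Σc , bal) → ∈-filter⁺ (λ v → n ∣? moment v) (IsComposition⇒∈-compositions n m c Σc) bal)

  balancedCompositions-unique : ∀ n m → Unique (balancedCompositions n m)
  balancedCompositions-unique n m = AllPairsₚ.filter⁺ (λ v → n ∣? moment v) (compositions-unique n m)

  sameOrbit-balanced⇒≡ : ∀ {n m} {a b : Vec ℕ (suc n)} → Coprime m (suc n) →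
    IsComposition (suc n) m a → Balanced a → Balanced b → SameOrbit a b → a ≡ b
  sameOrbit-balanced⇒≡ {n} {m} {a} {b} cop Σa bal-a bal-b (k , a↻k≡b) = begin
    a                         ≡⟨ rotate^-multiple q a ⟨
    rotate^ (q * suc n) a     ≡⟨ cong (λ j → rotate^ j a) k≡q*n ⟨
    rotate^ k a               ≡⟨ a↻k≡b ⟩
    b                         ∎
    where
    open ≡-Reasoning
    n∣a+km : suc n ∣ moment a + k * m
    n∣a+km = subst (λ s → suc n ∣ moment a + k * s) Σa
      (Equivalence.to (balanced-rotate^ k a) (subst Balanced (sym a↻k≡b) bal-b))
    n∣k : suc n ∣ k
    n∣k = coprime-∣+*⇒∣ k cop bal-a n∣a+km
    q = _∣_.quotient n∣k
    k≡q*n = _∣_.equality n∣k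

  balancedCompositions-orbits : ∀ {n m} → Coprime m (suc n) →
    NumOrbits (suc n) m (length (balancedCompositions (suc n) m))
  balancedCompositions-orbits {n} {m} cop =
    balancedCompositions (suc n) m , refl ,
    All.tabulate (λ c∈ → proj₁ (Equivalence.to ∈-balancedCompositions c∈)) ,
    AllPairs-weaken-∈ distinct⇒otherOrbit (balancedCompositions-unique (suc n) m) ,
    someRotationBalanced
    where
    distinct⇒otherOrbit : ∀ {a b} → a ∈ balancedCompositions (suc n) m → b ∈ balancedCompositions (suc n) m →
      a ≢ b → ¬ SameOrbit a b
    distinct⇒otherOrbit a∈ b∈ a≢b a~b =
      let Σa , bal-a = Equivalence.to ∈-balancedCompositions a∈
          _  , bal-b = Equivalence.to (∈-balancedCompositions {m = m}) b∈
      in a≢b (sameOrbit-balanced⇒≡ cop Σa bal-a bal-b a~b)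
    someRotationBalanced : ∀ c → IsComposition (suc n) m c → Any (SameOrbit c) (balancedCompositions (suc n) m)
    someRotationBalanced c Σc with coprime⇒∃∣+* cop (moment c)
    ... | k , n∣c+km = Any.map (k ,_) (Equivalence.from (∈-balancedCompositions {m = m})
      ( trans (sum-rotate^ k c) Σc
      , Equivalence.from (balanced-rotate^ k c) (subst (λ s → suc n ∣ moment c + k * s) (sym Σc) n∣c+km)))

open CyclicCompositions

module LaplacianCone where

  open import Data.Nat using (_%_; _≡ᵇ_)
  import Data.Nat.Properties as ℕ
  open import Data.Nat.Divisibility using (divides)
  open import Data.Nat.DivMod using (_/_; m<n⇒m%n≡m; n%n≡0; m%n<n; m*[n/m]≡n; m*n/n≡m)
  import Data.Nat.Tactic.RingSolver as ℕ-Solver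
  open import Data.Integer as ℤ using (ℤ; +_; -[1+_]; _+_; _*_; -_; _-_)
  import Data.Integer.Properties as ℤ
  open import Data.Integer.Tactic.RingSolver using (solve-∀)
  open import Data.Bool using (Bool; true; false; T; if_then_else_; _∨_)
  open import Data.Fin as Fin using (Fin; toℕ; fromℕ<)
  open import Data.Fin.Properties using (toℕ<n; toℕ-fromℕ<)
  open import Data.Vec using (lookup; tabulate)
  open import Data.Vec.Properties using (tabulate∘lookup; lookup∘tabulate; tabulate-cong)
  open import Data.List.Properties using (length-map)
  open import Data.Empty using (⊥-elim)

  Σℤ-cong : ∀ n {f g : Fin n → ℤ} → (∀ j → f j ≡ g j) → Σℤ n f ≡ Σℤ n g
  Σℤ-cong zero    f≗g = refl
  Σℤ-cong (suc n) f≗g = cong₂ _+_ (f≗g Fin.zero) (Σℤ-cong n (λ j → f≗g (Fin.suc j)))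

  Σℤ-distrib-+ : ∀ n (f g : Fin n → ℤ) → Σℤ n (λ j → f j + g j) ≡ Σℤ n f + Σℤ n g
  Σℤ-distrib-+ zero    f g = refl
  Σℤ-distrib-+ (suc n) f g rewrite Σℤ-distrib-+ n (λ j → f (Fin.suc j)) (λ j → g (Fin.suc j)) =
    lemma (f Fin.zero) (g Fin.zero) _ _
    where
    lemma : ∀ a b c d → a + b + (c + d) ≡ a + c + (b + d)
    lemma = solve-∀

  Σℤ-zero : ∀ n → Σℤ n (λ _ → + 0) ≡ + 0
  Σℤ-zero zero    = refl
  Σℤ-zero (suc n) = trans (ℤ.+-identityˡ _) (Σℤ-zero n)

  Σℤ-indicator : ∀ n (g : ℕ → ℤ) a → a < n →
    Σℤ n (λ j → if toℕ j ≡ᵇ a then g (toℕ j) else + 0) ≡ g a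
  Σℤ-indicator (suc n) g zero    _         = trans (cong (λ z → g 0 + z) (Σℤ-zero n)) (ℤ.+-identityʳ (g 0))
  Σℤ-indicator (suc n) g (suc a) (s≤s a<n) = trans (ℤ.+-identityˡ _) (Σℤ-indicator n (λ k → g (suc k)) a a<n)

  ≡ᵇ-map : ∀ {a b c d} → (a ≡ b → c ≡ d) → T (a ≡ᵇ b) → T (c ≡ᵇ d)
  ≡ᵇ-map {a} {b} {c} {d} f a≐b = ℕ.≡⇒≡ᵇ c d (f (ℕ.≡ᵇ⇒≡ a b a≐b))

  ≡ᵇ-cong : ∀ {a b c d} → (a ≡ b ⇔ c ≡ d) → (a ≡ᵇ b) ≡ (c ≡ᵇ d)
  ≡ᵇ-cong {a} {b} {c} {d} a≡b⇔c≡d with a ≡ᵇ b in e₁ | c ≡ᵇ d in e₂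
  ... | false | false = refl
  ... | true  | true  = refl
  ... | true  | false = ⊥-elim (subst T e₂ (≡ᵇ-map (Equivalence.to a≡b⇔c≡d) (subst T (sym e₁) _)))
  ... | false | true  = ⊥-elim (subst T e₁ (≡ᵇ-map (Equivalence.from a≡b⇔c≡d) (subst T (sym e₂) _)))

  if-exclusive-* : (b₁ b₂ b₃ : Bool) (d X : ℤ) →
    (T b₁ → ¬ T b₂) → (T b₁ → ¬ T b₃) → (T b₂ → ¬ T b₃) →
    (if b₁ then d else (if b₂ ∨ b₃ then -[1+ 0 ] else + 0)) * X
      ≡ (if b₁ then d * X else + 0) + (if b₂ then - X else + 0) + (if b₃ then - X else + 0)
  if-exclusive-* true  true  _     d X ¬12 _   _   = ⊥-elim (¬12 _ _)
  if-exclusive-* true  false true  d X _   ¬13 _   = ⊥-elim (¬13 _ _)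
  if-exclusive-* true  false false d X _   _   _   = sym (trans (ℤ.+-identityʳ _) (ℤ.+-identityʳ _))
  if-exclusive-* false true  true  d X _   _   ¬23 = ⊥-elim (¬23 _ _)
  if-exclusive-* false true  false d X _   _   _   = trans (ℤ.-1*i≡-i X) (sym (trans (ℤ.+-identityʳ _) (ℤ.+-identityˡ _)))
  if-exclusive-* false false true  d X _   _   _   = trans (ℤ.-1*i≡-i X) (sym (ℤ.+-identityˡ _))
  if-exclusive-* false false false d X _   _   _   = refl

  lookup-ext : ∀ {A : Set} {n} {u v : Vec A n} → (∀ i → lookup u i ≡ lookup v i) → u ≡ v
  lookup-ext {u = u} {v} u≗v = trans (sym (tabulate∘lookup u)) (trans (tabulate-cong u≗v) (tabulate∘lookup v))

  -- Indices are handled in ℕ so that cyclic neighbours are plain arithmetic; out of range gives d.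
  lookupOr : ∀ {A : Set} {n} → A → Vec A n → ℕ → A
  lookupOr d []       _       = d
  lookupOr d (x ∷ xs) zero    = x
  lookupOr d (x ∷ xs) (suc k) = lookupOr d xs k

  lookup≡lookupOr : ∀ {A : Set} {n} (d : A) (v : Vec A n) (i : Fin n) → lookup v i ≡ lookupOr d v (toℕ i)
  lookup≡lookupOr d (x ∷ v) Fin.zero    = refl
  lookup≡lookupOr d (x ∷ v) (Fin.suc i) = lookup≡lookupOr d v i

  lookupOr-tabulate : ∀ {A : Set} {n} (d : A) (f : Fin n → A) k (k<n : k < n) → lookupOr d (tabulate f) k ≡ f (fromℕ< k<n)
  lookupOr-tabulate {n = suc n} d f zero    _         = refl
  lookupOr-tabulate {n = suc n} d f (suc k) (s≤s k<n) = lookupOr-tabulate d (λ i → f (Fin.suc i)) k k<n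

  module Stencil (p : ℕ) where

    n : ℕ
    n = suc (suc (suc p))

    next prev : ℕ → ℕ
    next k = suc k % n
    prev zero    = suc (suc p)
    prev (suc k) = k

    next-cases : ∀ {k} → k < n → (suc k < n × next k ≡ suc k) ⊎ (suc k ≡ n × next k ≡ 0)
    next-cases {k} k<n with ℕ.m≤n⇒m<n∨m≡n k<n
    ... | inj₁ 1+k<n = inj₁ (1+k<n , m<n⇒m%n≡m 1+k<n)
    ... | inj₂ 1+k≡n = inj₂ (1+k≡n , trans (cong (_% n) 1+k≡n) (n%n≡0 n))

    next-prev : ∀ {k} → k < n → next (prev k) ≡ k
    next-prev {zero}  _   = n%n≡0 n
    next-prev {suc k} k<n = m<n⇒m%n≡m k<n

    prev-next : ∀ {k} → k < n → prev (next k) ≡ k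
    prev-next k<n with next-cases k<n
    ... | inj₁ (_ , e)      rewrite e = refl
    ... | inj₂ (1+k≡n , e)  rewrite e = sym (ℕ.suc-injective 1+k≡n)

    next≢id : ∀ {k} → k < n → next k ≢ k
    next≢id k<n e with next-cases k<n
    ... | inj₁ (_ , e′)     = ℕ.1+n≢n (trans (sym e′) e)
    ... | inj₂ (1+k≡n , e′) with trans (sym e′) e
    ...   | refl with 1+k≡n
    ...     | ()

    next²≢id : ∀ {k} → k < n → next (next k) ≢ k
    next²≢id k<n e with next-cases k<n
    ... | inj₂ (1+k≡n , e′) rewrite e′ with e
    ...   | refl with 1+k≡n
    ...     | ()
    next²≢id k<n e | inj₁ (1+k<n , e′) rewrite e′ with next-cases 1+k<n
    ...   | inj₁ (_ , e″) = ℕ.m≢1+n+m _ {1} (trans (sym e) e″)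
    ...   | inj₂ (2+k≡n , e″) with trans (sym e″) e
    ...     | refl with 2+k≡n
    ...       | ()

    ≡next⇔prev≡ : ∀ {k l} → k < n → l < n → (k ≡ next l ⇔ l ≡ prev k)
    ≡next⇔prev≡ k<n l<n = mk⇔
      (λ { refl → sym (prev-next l<n) })
      (λ { refl → sym (next-prev k<n) })

    next-< : ∀ k → next k < n
    next-< k = m%n<n (suc k) n

    prev-< : ∀ {k} → k < n → prev k < n
    prev-< {zero}  _   = ℕ.n<1+n _
    prev-< {suc k} k<n = ℕ.<-trans (ℕ.n<1+n k) k<n

    diag : ℕ → ℤ
    diag k = if k ≡ᵇ 0 then + 3 else + 2

    stencil : (ℕ → ℤ) → ℕ → ℤ
    stencil x k = diag k * x k - x (next k) - x (prev k)

    -- n ≥ 3 keeps i, next i and prev i distinct, so the three indicators never overlap.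
    Lmat-* : (i j : Fin n) (X : ℤ) → Lmat n i j * X ≡
        (if toℕ j ≡ᵇ toℕ i        then diag (toℕ i) * X else + 0)
      + (if toℕ j ≡ᵇ next (toℕ i) then - X              else + 0)
      + (if toℕ j ≡ᵇ prev (toℕ i) then - X              else + 0)
    Lmat-* i j X
      rewrite ≡ᵇ-cong {toℕ i} {toℕ j} (mk⇔ sym sym)
            | ≡ᵇ-cong (≡next⇔prev≡ (toℕ<n i) (toℕ<n j)) =
      if-exclusive-* (j′ ≡ᵇ i′) (j′ ≡ᵇ next i′) (j′ ≡ᵇ prev i′) (diag i′) X
        (λ t₁ t₂ → next≢id i<n (trans (sym (j≡i⁺ t₂)) (j≡i t₁)))
        (λ t₁ t₃ → next≢id i<n (trans (cong next (trans (sym (j≡i t₁)) (j≡i⁻ t₃))) (next-prev i<n)))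
        (λ t₂ t₃ → next²≢id i<n (trans (cong next (trans (sym (j≡i⁺ t₂)) (j≡i⁻ t₃))) (next-prev i<n)))
      where
      i′ = toℕ i
      j′ = toℕ j
      i<n = toℕ<n i
      j≡i : T (j′ ≡ᵇ i′) → j′ ≡ i′
      j≡i = ℕ.≡ᵇ⇒≡ j′ i′
      j≡i⁺ : T (j′ ≡ᵇ next i′) → j′ ≡ next i′
      j≡i⁺ = ℕ.≡ᵇ⇒≡ j′ (next i′)
      j≡i⁻ : T (j′ ≡ᵇ prev i′) → j′ ≡ prev i′
      j≡i⁻ = ℕ.≡ᵇ⇒≡ j′ (prev i′)

    Lapply-stencil : (v : Vec ℤ n) (i : Fin n) → Lapply n v i ≡ stencil (lookupOr (+ 0) v) (toℕ i)
    Lapply-stencil v i = begin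
      Σℤ n (λ j → Lmat n i j * lookup v j)    ≡⟨ Σℤ-cong n (λ j → cong (Lmat n i j *_) (lookup≡lookupOr (+ 0) v j)) ⟩
      Σℤ n (λ j → Lmat n i j * x (toℕ j))     ≡⟨ Σℤ-cong n (λ j → Lmat-* i j (x (toℕ j))) ⟩
      Σℤ n (λ j → A j + B j + C j)           ≡⟨ Σℤ-distrib-+ n (λ j → A j + B j) C ⟩
      Σℤ n (λ j → A j + B j) + Σℤ n C        ≡⟨ cong (_+ Σℤ n C) (Σℤ-distrib-+ n A B) ⟩
      Σℤ n A + Σℤ n B + Σℤ n C               ≡⟨ cong₂ (λ a b → a + b + Σℤ n C)
                                                      (Σℤ-indicator n (λ l → diag k * x l) k (toℕ<n i))
                                                      (Σℤ-indicator n (λ l → - x l) (next k) (next-< k)) ⟩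
      diag k * x k - x (next k) + Σℤ n C     ≡⟨ cong (λ c → diag k * x k - x (next k) + c)
                                                      (Σℤ-indicator n (λ l → - x l) (prev k) (prev-< (toℕ<n i))) ⟩
      stencil x k                            ∎
      where
      open ≡-Reasoning
      x = lookupOr (+ 0) v
      k = toℕ i
      A B C : Fin n → ℤ
      A j = if toℕ j ≡ᵇ k        then diag k * x (toℕ j) else + 0
      B j = if toℕ j ≡ᵇ next k   then - x (toℕ j)        else + 0
      C j = if toℕ j ≡ᵇ prev k   then - x (toℕ j)        else + 0

  -- The middle rows of L are second differences, with the sign of the graph Laplacian.
  Δ² : (ℕ → ℤ) → ℕ → ℤ
  Δ² x j = + 2 * x (suc j) - x (suc (suc j)) - x j

  Δ²-determines : ∀ {x y : ℕ → ℤ} K → x 0 ≡ y 0 → x 1 ≡ y 1 →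
    (∀ j → suc (suc j) ℕ.≤ K → Δ² x j ≡ Δ² y j) → ∀ k → k ℕ.≤ K → x k ≡ y k
  Δ²-determines {x} {y} K x₀≡y₀ x₁≡y₁ Δ²x≡Δ²y = λ
    { zero    _       → x₀≡y₀
    ; (suc k) 1+k≤K → proj₂ (consecutive k 1+k≤K) }
    where
    solve-next : ∀ (z : ℕ → ℤ) j → z (suc (suc j)) ≡ + 2 * z (suc j) - z j - Δ² z j
    solve-next z j = lemma (z j) (z (suc j)) (z (suc (suc j)))
      where
      lemma : ∀ a b c → c ≡ + 2 * b - a - (+ 2 * b - c - a)
      lemma = solve-∀
    consecutive : ∀ j → suc j ℕ.≤ K → x j ≡ y j × x (suc j) ≡ y (suc j)
    consecutive zero    _       = x₀≡y₀ , x₁≡y₁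
    consecutive (suc j) 2+j≤K with consecutive j (ℕ.<⇒≤ 2+j≤K)
    ... | xⱼ≡yⱼ , xⱼ₊₁≡yⱼ₊₁ = xⱼ₊₁≡yⱼ₊₁ , (begin
      x (suc (suc j))                 ≡⟨ solve-next x j ⟩
      + 2 * x (suc j) - x j - Δ² x j  ≡⟨ cong₂ (λ a b → + 2 * a - b - Δ² x j) xⱼ₊₁≡yⱼ₊₁ xⱼ≡yⱼ ⟩
      + 2 * y (suc j) - y j - Δ² x j  ≡⟨ cong (λ d → + 2 * y (suc j) - y j - d) (Δ²x≡Δ²y j 2+j≤K) ⟩
      + 2 * y (suc j) - y j - Δ² y j  ≡⟨ solve-next y j ⟨
      y (suc (suc j))                 ∎)
      where open ≡-Reasoning

  prefix : (ℕ → ℕ) → ℕ → ℕ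
  prefix c zero    = c 0
  prefix c (suc k) = prefix c k ℕ.+ c (suc k)

  prefixTotal : (ℕ → ℕ) → ℕ → ℕ
  prefixTotal c zero    = 0
  prefixTotal c (suc k) = prefixTotal c k ℕ.+ prefix c k

  -- The vector λ with λ₀ = m, λ₁ - λ₀ = u - c 0 and (L λ)ₖ = c k on the rows that are second differences.
  profile : (ℕ → ℕ) → ℤ → ℤ → ℕ → ℤ
  profile c m u zero    = m
  profile c m u (suc k) = profile c m u k + (u - + prefix c k)

  module _ (c : ℕ → ℕ) (m u : ℤ) where

    private
      S = profile c m u

    profile-closed : ∀ k → S k ≡ m + + k * u - + prefixTotal c k
    profile-closed zero    = lemma m u
      where
      lemma : ∀ m u → m ≡ m + + 0 * u - + 0
      lemma = solve-∀
    profile-closed (suc k) rewrite profile-closed k | ℤ.pos-+ (prefixTotal c k) (prefix c k) =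
      lemma m u (+ k) (+ prefixTotal c k) (+ prefix c k)
      where
      lemma : ∀ m u k t p → m + k * u - t + (u - p) ≡ m + (+ 1 + k) * u - (t + p)
      lemma = solve-∀

    Δ²-profile : ∀ j → Δ² S j ≡ + c (suc j)
    Δ²-profile j rewrite ℤ.pos-+ (prefix c j) (c (suc j)) = lemma (S j) u (+ prefix c j) (+ c (suc j))
      where
      lemma : ∀ s u p q → + 2 * (s + (u - p)) - (s + (u - p) + (u - (p + q))) - s ≡ q
      lemma = solve-∀

    profile-first-row : ∀ k → + 3 * S 0 - S 1 - S k ≡ + c 0 + (m - S (suc k)) + (m - + prefix c k)
    profile-first-row k = lemma m u (+ c 0) (S k) (+ prefix c k)
      where
      lemma : ∀ m u c s p → + 3 * m - (m + (u - c)) - s ≡ c + (m - (s + (u - p))) + (m - p)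
      lemma = solve-∀

    profile-last-row : ∀ k → + 2 * S (suc k) - S 0 - S k ≡ + c (suc k) + (S (suc (suc k)) - m)
    profile-last-row k = trans (lemma (S (suc k)) m (S k) (S (suc (suc k)))) (cong (_+ (S (suc (suc k)) - m)) (Δ²-profile k))
      where
      lemma : ∀ a m d e → + 2 * a - m - d ≡ (+ 2 * a - e - d) + (e - m)
      lemma = solve-∀

  prefix-∷ : ∀ x {n} (xs : Vec ℕ n) k → prefix (lookupOr 0 (x ∷ xs)) (suc k) ≡ x ℕ.+ prefix (lookupOr 0 xs) k
  prefix-∷ x xs zero    = refl
  prefix-∷ x xs (suc k) = trans (cong (ℕ._+ lookupOr 0 xs (suc k)) (prefix-∷ x xs k)) (ℕ.+-assoc x _ _)

  prefix-lookupOr : ∀ {k} (v : Vec ℕ (suc k)) → prefix (lookupOr 0 v) k ≡ sumℕ v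
  prefix-lookupOr {zero}  (x ∷ []) = sym (ℕ.+-identityʳ x)
  prefix-lookupOr {suc k} (x ∷ xs) = trans (prefix-∷ x xs k) (cong (x ℕ.+_) (prefix-lookupOr xs))

  prefixTotal-lookupOr : ∀ {n} (v : Vec ℕ n) → prefixTotal (lookupOr 0 v) n ≡ moment v
  prefixTotal-lookupOr []                = refl
  prefixTotal-lookupOr {suc n} (x ∷ xs) = trans (prefixTotal-∷ n) (cong (suc n ℕ.* x ℕ.+_) (prefixTotal-lookupOr xs))
    where
    prefixTotal-∷ : ∀ k → prefixTotal (lookupOr 0 (x ∷ xs)) (suc k) ≡ suc k ℕ.* x ℕ.+ prefixTotal (lookupOr 0 xs) k
    prefixTotal-∷ zero    = sym (trans (ℕ.+-identityʳ (x ℕ.+ 0)) (ℕ.+-identityʳ x))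
    prefixTotal-∷ (suc k) rewrite prefixTotal-∷ k | prefix-∷ x xs k =
      lemma (suc k ℕ.* x) x (prefixTotal (lookupOr 0 xs) k) (prefix (lookupOr 0 xs) k)
      where
      lemma : ∀ a x t p → a ℕ.+ t ℕ.+ (x ℕ.+ p) ≡ x ℕ.+ a ℕ.+ (t ℕ.+ p)
      lemma = ℕ-Solver.solve-∀

  +-difference⇒≡ : ∀ a b c → a + (b - c) ≡ a → b ≡ c
  +-difference⇒≡ a b c e = begin
    b                     ≡⟨ lemma a b c ⟩
    c + (a + (b - c)) - a ≡⟨ cong (λ z → c + z - a) e ⟩
    c + a - a             ≡⟨ lemma′ a c ⟩
    c                     ∎
    where
    open ≡-Reasoning
    lemma : ∀ a b c → b ≡ c + (a + (b - c)) - a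
    lemma = solve-∀
    lemma′ : ∀ a c → c + a - a ≡ c
    lemma′ = solve-∀

  module ConePoints (p m : ℕ) where
    open Stencil p

    private
      K = suc (suc p)

    stencil-middle : ∀ x j → suc (suc j) < n → stencil x (suc j) ≡ Δ² x j
    stencil-middle x j 2+j<n = cong (λ k → + 2 * x (suc j) - x k - x j) (m<n⇒m%n≡m 2+j<n)

    stencil-last : ∀ x → stencil x K ≡ + 2 * x K - x 0 - x (suc p)
    stencil-last x = cong (λ k → + 2 * x K - x k - x (suc p)) (n%n≡0 n)

    row-cases : (R : ℕ → Set) → R 0 → (∀ j → suc (suc j) < n → R (suc j)) → R K → ∀ k → k < n → R k
    row-cases R first middle last zero    _           = first
    row-cases R first middle last (suc j) (s≤s 1+j<n) with ℕ.m≤n⇒m<n∨m≡n 1+j<n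
    ... | inj₁ 2+j<n = middle j (s≤s 2+j<n)
    ... | inj₂ refl  = last

    module _ (c : ℕ → ℕ) (u : ℤ) (x : ℕ → ℤ) (x≡S : ∀ k → k ℕ.≤ K → x k ≡ profile c (+ m) u k) where

      private
        S = profile c (+ m) u

      stencil-first-profile : stencil x 0 ≡ + c 0 + (+ m - S n) + (+ m - + prefix c K)
      stencil-first-profile rewrite x≡S 0 z≤n | x≡S 1 (s≤s z≤n) | x≡S K ℕ.≤-refl = profile-first-row c (+ m) u K

      stencil-middle-profile : ∀ j → suc (suc j) < n → stencil x (suc j) ≡ + c (suc j)
      stencil-middle-profile j (s≤s 2+j≤K)
        rewrite stencil-middle x j (s≤s 2+j≤K)
              | x≡S j (ℕ.≤-trans (ℕ.n≤1+n j) (ℕ.<⇒≤ 2+j≤K))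
              | x≡S (suc j) (ℕ.<⇒≤ 2+j≤K)
              | x≡S (suc (suc j)) 2+j≤K
              = Δ²-profile c (+ m) u j

      stencil-last-profile : stencil x K ≡ + c K + (S n - + m)
      stencil-last-profile rewrite stencil-last x | x≡S K ℕ.≤-refl | x≡S 0 z≤n | x≡S (suc p) (ℕ.n≤1+n _) =
        profile-last-row c (+ m) u (suc p)

      stencil-profile : (∀ k → k < n → stencil x k ≡ + c k) ⇔ (S n ≡ + m × prefix c K ≡ m)
      stencil-profile = mk⇔ to from
        where
        to : (∀ k → k < n → stencil x k ≡ + c k) → S n ≡ + m × prefix c K ≡ m
        to rows = Sₙ≡m , ℤ.+-injective (sym (+-difference⇒≡ (+ c 0) (+ m) (+ prefix c K) first))
          where
          Sₙ≡m = +-difference⇒≡ (+ c K) (S n) (+ m) (trans (sym stencil-last-profile) (rows K ℕ.≤-refl))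
          first : + c 0 + (+ m - + prefix c K) ≡ + c 0
          first = begin
            + c 0 + (+ m - + prefix c K)                  ≡⟨ lemma (+ c 0) (+ m) (+ prefix c K) ⟩
            + c 0 + (+ m - + m) + (+ m - + prefix c K)    ≡⟨ cong (λ s → + c 0 + (+ m - s) + (+ m - + prefix c K)) Sₙ≡m ⟨
            + c 0 + (+ m - S n) + (+ m - + prefix c K)    ≡⟨ stencil-first-profile ⟨
            stencil x 0                                   ≡⟨ rows 0 (s≤s z≤n) ⟩
            + c 0                                         ∎
            where
            open ≡-Reasoning
            lemma : ∀ a m p → a + (m - p) ≡ a + (m - m) + (m - p)
            lemma = solve-∀
        from : S n ≡ + m × prefix c K ≡ m → ∀ k → k < n → stencil x k ≡ + c k
        from (Sₙ≡m , Pₖ≡m) = row-cases (λ k → stencil x k ≡ + c k) first stencil-middle-profile last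
          where
          first : stencil x 0 ≡ + c 0
          first rewrite stencil-first-profile | Sₙ≡m | Pₖ≡m = lemma (+ c 0) (+ m)
            where
            lemma : ∀ a b → a + (b - b) + (b - b) ≡ a
            lemma = solve-∀
          last : stencil x K ≡ + c K
          last rewrite stencil-last-profile | Sₙ≡m = lemma (+ c K) (+ m)
            where
            lemma : ∀ a b → a + (b - b) ≡ a
            lemma = solve-∀

    profile-closes : ∀ c u → profile c (+ m) u n ≡ + m ⇔ + prefixTotal c n ≡ + n * u
    profile-closes c u = mk⇔
      (λ Sₙ≡m → sym (+-difference⇒≡ (+ m) (+ n * u) (+ prefixTotal c n)
                      (trans (lemma (+ m) (+ n * u) (+ prefixTotal c n)) (trans (sym (profile-closed c (+ m) u n)) Sₙ≡m))))
      (λ T≡nu → trans (profile-closed c (+ m) u n) (trans (cong (λ t → + m + + n * u - t) T≡nu) (lemma′ (+ m) (+ n * u))))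
      where
      lemma : ∀ m a t → m + (a - t) ≡ m + a - t
      lemma = solve-∀
      lemma′ : ∀ m a → m + a - a ≡ m
      lemma′ = solve-∀

    slope : Vec ℕ n → ℤ
    slope c = + (moment c / n)

    conePoint : Vec ℕ n → Vec ℤ n
    conePoint c = tabulate (λ i → profile (lookupOr 0 c) (+ m) (slope c) (toℕ i))

    conePoint-profile : ∀ c k → k ℕ.≤ K → lookupOr (+ 0) (conePoint c) k ≡ profile (lookupOr 0 c) (+ m) (slope c) k
    conePoint-profile c k k≤K =
      trans (lookupOr-tabulate (+ 0) (λ i → S (toℕ i)) k (s≤s k≤K)) (cong S (toℕ-fromℕ< (s≤s k≤K)))
      where S = profile (lookupOr 0 c) (+ m) (slope c)

    Lapply-conePoint : ∀ {c} → IsComposition n m c → Balanced c → ∀ i → Lapply n (conePoint c) i ≡ + lookup c i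
    Lapply-conePoint {c} Σc≡m n∣c i = begin
      Lapply n (conePoint c) i                         ≡⟨ Lapply-stencil (conePoint c) i ⟩
      stencil (lookupOr (+ 0) (conePoint c)) (toℕ i)   ≡⟨ Equivalence.from (stencil-profile c′ (slope c) _ (conePoint-profile c))
                                                            (closes , trans (prefix-lookupOr c) Σc≡m) (toℕ i) (toℕ<n i) ⟩
      + c′ (toℕ i)                                     ≡⟨ cong +_ (lookup≡lookupOr 0 c i) ⟨
      + lookup c i                                     ∎
      where
      open ≡-Reasoning
      c′ = lookupOr 0 c
      closes : profile c′ (+ m) (slope c) n ≡ + m
      closes = Equivalence.from (profile-closes c′ (slope c))
        (trans (cong +_ (trans (prefixTotal-lookupOr c) (sym (m*[n/m]≡n n∣c)))) (ℤ.pos-* n (moment c / n)))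

    +≡n*⇒natural : ∀ {a} w → + a ≡ + n * w → ∃[ k ] w ≡ + k × a ≡ k ℕ.* n
    +≡n*⇒natural (+ k)     e  = k , refl , trans (ℤ.+-injective (trans e (sym (ℤ.pos-* n k)))) (ℕ.*-comm n k)
    +≡n*⇒natural -[1+ _ ] ()

    compositionOf : Vec ℤ n → Vec ℕ n
    compositionOf v = tabulate (λ i → ℤ.∣ Lapply n v i ∣)

    module _ {v : Vec ℤ n} (cone : ConePoint K m v) where

      private
        x  = lookupOr (+ 0) v
        c  = compositionOf v
        c′ = lookupOr 0 c
        -- chosen so that the profile agrees with v at index 1
        u  = x 1 - x 0 + + c′ 0
        S  = profile c′ (+ m) u

      cone-stencil : ∀ k → k < n → stencil x k ≡ + c′ k
      cone-stencil k k<n = sym (begin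
        + c′ k                               ≡⟨ cong +_ (lookupOr-tabulate 0 (λ i → ℤ.∣ Lapply n v i ∣) k k<n) ⟩
        + ℤ.∣ Lapply n v (fromℕ< k<n) ∣      ≡⟨ ℤ.0≤i⇒+∣i∣≡i (proj₁ cone (fromℕ< k<n)) ⟩
        Lapply n v (fromℕ< k<n)              ≡⟨ Lapply-stencil v (fromℕ< k<n) ⟩
        stencil x (toℕ (fromℕ< k<n))         ≡⟨ cong (stencil x) (toℕ-fromℕ< k<n) ⟩
        stencil x k                          ∎)
        where open ≡-Reasoning

      cone-profile : ∀ k → k ℕ.≤ K → x k ≡ S k
      cone-profile = Δ²-determines K x₀≡m x₁≡S₁ Δ²x≡Δ²S
        where
        x₀≡m : x 0 ≡ + m
        x₀≡m = trans (sym (lookup≡lookupOr (+ 0) v Fin.zero)) (proj₂ cone)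
        x₁≡S₁ : x 1 ≡ + m + (u - + c′ 0)
        x₁≡S₁ = trans (lemma (x 1) (x 0) (+ c′ 0)) (cong (λ b → b + (u - + c′ 0)) x₀≡m)
          where
          lemma : ∀ a b c → a ≡ b + ((a - b + c) - c)
          lemma = solve-∀
        Δ²x≡Δ²S : ∀ j → suc (suc j) ℕ.≤ K → Δ² x j ≡ Δ² S j
        Δ²x≡Δ²S j 2+j≤K = begin
          Δ² x j              ≡⟨ stencil-middle x j (s≤s 2+j≤K) ⟨
          stencil x (suc j)   ≡⟨ cone-stencil (suc j) (s≤s (ℕ.<⇒≤ 2+j≤K)) ⟩
          + c′ (suc j)        ≡⟨ Δ²-profile c′ (+ m) u j ⟨
          Δ² S j              ∎
          where open ≡-Reasoning

      private
        closes×sum : S n ≡ + m × prefix c′ K ≡ m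
        closes×sum = Equivalence.to (stencil-profile c′ u x cone-profile) cone-stencil

        moment≡n*u : + moment c ≡ + n * u
        moment≡n*u = trans (cong +_ (sym (prefixTotal-lookupOr c))) (Equivalence.to (profile-closes c′ u) (proj₁ closes×sum))

        natural-slope : ∃[ k ] u ≡ + k × moment c ≡ k ℕ.* n
        natural-slope = +≡n*⇒natural u moment≡n*u

      cone-IsComposition : IsComposition n m c
      cone-IsComposition = trans (sym (prefix-lookupOr c)) (proj₂ closes×sum)

      cone-Balanced : Balanced c
      cone-Balanced = let k , _ , moment≡kn = natural-slope in divides k moment≡kn

      cone≡conePoint : v ≡ conePoint c
      cone≡conePoint = lookup-ext (λ i → begin
        lookup v i                          ≡⟨ lookup≡lookupOr (+ 0) v i ⟩
        x (toℕ i)                           ≡⟨ cone-profile (toℕ i) (ℕ.≤-pred (toℕ<n i)) ⟩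
        S (toℕ i)                           ≡⟨ cong (λ w → profile c′ (+ m) w (toℕ i)) u≡slope ⟩
        profile c′ (+ m) (slope c) (toℕ i)  ≡⟨ lookup∘tabulate (λ j → profile c′ (+ m) (slope c) (toℕ j)) i ⟨
        lookup (conePoint c) i              ∎)
        where
        open ≡-Reasoning
        u≡slope : u ≡ slope c
        u≡slope = let k , u≡k , moment≡kn = natural-slope in
          trans u≡k (cong +_ (sym (trans (cong (_/ n) moment≡kn) (m*n/n≡m k n))))

    private
      reps = balancedCompositions n m

    Lapply-conePoint-∈ : ∀ {c} → c ∈ reps → ∀ i → Lapply n (conePoint c) i ≡ + lookup c i
    Lapply-conePoint-∈ {c} c∈ =
      let Σc≡m , n∣c = Equivalence.to ∈-balancedCompositions c∈ in Lapply-conePoint {c} Σc≡m n∣c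

    conePoint-injective-∈ : ∀ {a b} → a ∈ reps → b ∈ reps → conePoint a ≡ conePoint b → a ≡ b
    conePoint-injective-∈ {a} {b} a∈ b∈ e = lookup-ext (λ i → ℤ.+-injective (begin
      + lookup a i               ≡⟨ Lapply-conePoint-∈ a∈ i ⟨
      Lapply n (conePoint a) i   ≡⟨ cong (λ w → Lapply n w i) e ⟩
      Lapply n (conePoint b) i   ≡⟨ Lapply-conePoint-∈ b∈ i ⟩
      + lookup b i               ∎))
      where open ≡-Reasoning

    ConePoint⇔∈-map-conePoint : ∀ v → ConePoint K m v ⇔ v ∈ List.map conePoint reps
    ConePoint⇔∈-map-conePoint v = mk⇔
      (λ cone → subst (_∈ List.map conePoint reps) (sym (cone≡conePoint {v} cone))
        (∈-map⁺ conePoint (Equivalence.from ∈-balancedCompositions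
          (cone-IsComposition {v} cone , cone-Balanced {v} cone))))
      (λ v∈ → let c , c∈ , v≡ = ∈-map⁻ conePoint v∈ in
        subst (ConePoint K m) (sym v≡)
          ((λ i → subst (+ 0 ℤ.≤_) (sym (Lapply-conePoint-∈ c∈ i)) (ℤ.+≤+ z≤n)) , refl))

    conePoints-size : HasSize (ConePoint K m) (length reps)
    conePoints-size =
      List.map conePoint reps ,
      length-map conePoint reps ,
      AllPairsₚ.map⁺ (AllPairs-weaken-∈ (λ a∈ b∈ a≢b e → a≢b (conePoint-injective-∈ a∈ b∈ e))
                                        (balancedCompositions-unique n m)) ,
      ConePoint⇔∈-map-conePoint

open LaplacianCone

-- Only n ≥ 3 and gcd (m, n) = 1 are used.
theorem5p7 : (n' m : ℕ) → Prime (suc n') → 3 ≤ suc n' → 1 ≤ m → Coprime m (suc n')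
    → ∃ λ k → HasSize (ConePoint n' m) k × NumOrbits (suc n') m k
theorem5p7 zero          _ _ (s≤s ())       _ _
theorem5p7 (suc zero)    _ _ (s≤s (s≤s ())) _ _
theorem5p7 (suc (suc p)) m _ _ _ m⊥n =
  length (balancedCompositions (suc (suc (suc p))) m) , conePoints-size , balancedCompositions-orbits m⊥n
  where open ConePoints p m
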